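{- Let $n$ and $k$ be integers with $4\leq k\leq n$ and $k$ even, and let $M\subseteq E(K_n)$ be an edge set such that $|M|\geq k$ and $\Delta(K_n[M])=1$. Then $\kappa_k(K_n\setminus M)< n-\frac{k}{2}-1$.
   Context: For a graph $G$ and $S\subseteq V(G)$ with $|S|\geq 2$, an $S$-tree is a subgraph of $G$ that is a tree containing all vertices of $S$. Two $S$-trees $T,T'$ are internally disjoint if $E(T)\cap E(T')=\varnothing$ and $V(T)\cap V(T')=S$. $\kappa(S)$ is the maximum number of pairwise internally disjoint $S$-trees in $G$, and $\kappa_k(G)=\min\{\kappa(S): S\subseteq V(G),\ |S|=k\}$ (with $\kappa_k(G)=0$ if $G$ is disconnected). $K_n\setminus M$ is $K_n$ with the edges of $M$ deleted, $K_n[M]$ is the subgraph of $K_n$ induced by the edge set $M$, and $\Delta$ denotes maximum degree. -}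

module Defs where

open import Data.Nat using (ℕ; zero; suc; _+_; _⊔_; _<_)
open import Data.Fin using (Fin; zero; suc; inject₁; fromℕ) renaming (_≟_ to _≟F_)
open import Data.Fin.Subset using (Subset; _∈_)
open import Data.List using (List; length; filter; foldr; map)
open import Data.List.Membership.Propositional renaming (_∈_ to _∈L_)
open import Data.Fin.Base using () renaming (_<_ to _<F_)
open import Data.Product using (Σ; _×_; _,_; proj₁; proj₂)
open import Data.Sum using (_⊎_)
open import Data.List.Base using ()
open import Data.Vec.Functional using ()
open import Data.List using () renaming ([] to [])
open import Relation.Nullary using (¬_)
open import Relation.Nullary.Decidable using (_⊎-dec_)
open import Relation.Binary.PropositionalEquality using (_≡_; _≢_)
open import Relation.Binary.Construct.Closure.ReflexiveTransitive using (Star)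
open import Function.Definitions using (Injective)
open import Data.List using (allFin)

-- An edge set M of K_n is a list of pairs (u , v) with u < v (canonical
-- representative of the unordered edge uv), without repetitions.
EdgeList : ℕ → Set
EdgeList n = List (Fin n × Fin n)

InM : ∀ {n} → EdgeList n → Fin n → Fin n → Set
InM M u v = ((u , v) ∈L M) ⊎ ((v , u) ∈L M)

degM : ∀ {n} → EdgeList n → Fin n → ℕ
degM M v = length (filter (λ e → (v ≟F proj₁ e) ⊎-dec (v ≟F proj₂ e)) M)

maxDeg : ∀ {n} → EdgeList n → ℕ
maxDeg {n} M = foldr _⊔_ 0 (map (degM M) (allFin n))

AdjKnM : ∀ {n} → EdgeList n → Fin n → Fin n → Set
AdjKnM M u v = (u ≢ v) × ¬ InM M u v

Connected : ∀ {n} → (Fin n → Fin n → Set) → Set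
Connected {n} Adj = ∀ (u v : Fin n) → Star Adj u v

record Subgraph {n : ℕ} (Adj : Fin n → Fin n → Set) : Set₁ where
  field
    V : Fin n → Set
    E : Fin n → Fin n → Set
    E-sym : ∀ {u v} → E u v → E v u
    E-adj : ∀ {u v} → E u v → Adj u v
    E-V   : ∀ {u v} → E u v → V u

open Subgraph public

SubConnected : ∀ {n} {Adj : Fin n → Fin n → Set} → Subgraph Adj → Set
SubConnected T = ∀ u v → V T u → V T v → Star (E T) u v

Acyclic : ∀ {n} {Adj : Fin n → Fin n → Set} → Subgraph Adj → Set
Acyclic {n} T = ∀ (m : ℕ) (c : Fin (suc (suc (suc m))) → Fin n) →
  Injective _≡_ _≡_ c →
  (∀ (i : Fin (suc (suc m))) → E T (c (inject₁ i)) (c (suc i))) →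
  ¬ E T (c (fromℕ (suc (suc m)))) (c zero)

IsTree : ∀ {n} {Adj : Fin n → Fin n → Set} → Subgraph Adj → Set
IsTree T = SubConnected T × Acyclic T

record STree {n : ℕ} (Adj : Fin n → Fin n → Set) (S : Subset n) : Set₁ where
  field
    tree : Subgraph Adj
    isTree : IsTree tree
    contains : ∀ u → u ∈ S → V tree u

open STree public

InternallyDisjoint : ∀ {n} {Adj : Fin n → Fin n → Set} {S : Subset n} →
  STree Adj S → STree Adj S → Set
InternallyDisjoint {n} {S = S} T T' =
  (∀ u v → ¬ (E (tree T) u v × E (tree T') u v)) ×
  (∀ (u : Fin n) → ((V (tree T) u × V (tree T') u) → u ∈ S) ×
                   (u ∈ S → (V (tree T) u × V (tree T') u)))

KappaSLess : ∀ {n} → (Fin n → Fin n → Set) → Subset n → ℕ → Set₁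
KappaSLess Adj S b = ∀ (m : ℕ) (T : Fin m → STree Adj S) →
  (∀ i j → i ≢ j → InternallyDisjoint (T i) (T j)) → m < b

-- Take k edges s₁p₁, …, sₖpₖ of the matching M and put S = {sᵢ}, P = {pᵢ}; in K_n \ M each pᵢ is
-- non-adjacent to sᵢ. An S-tree either has a vertex outside S ∪ P, or lies inside S and then has k − 1
-- edges there, or contains some pᵢ; in the last case the first step from sᵢ towards pᵢ goes into S (an
-- edge inside S) or into P (a second vertex of P). Charging 2(k − 1) per vertex outside S ∪ P, 1 per
-- ordered adjacent pair of S and 2(k − 2) per vertex of P, every tree carries weight at least 2(k − 1).
-- Internally disjoint trees share no edge and no vertex outside S, so the total weight is at most
-- 2(k − 1)(n − 2k) + k(k − 1) + 2(k − 2)k = 2(k − 1)(n − k/2 − 1) − 2, and there are fewer than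
-- n − k/2 − 1 trees.

module Submission where

open import Defs
open import Data.Nat using (ℕ; zero; suc; _+_; _*_; _∸_; _⊔_; _≤_; _<_; _/_; _%_; z≤n; s≤s)
open import Data.Nat.Properties
open import Data.Nat.DivMod using (m≡m%n+[m/n]*n)
open import Data.Nat.Tactic.RingSolver using (solve-∀)
open import Data.Fin using (Fin) renaming (zero to fzero; suc to fsuc; _<_ to _<F_; _≟_ to _≟F_)
open import Data.Fin.Properties using () renaming (<-irrefl to <F-irrefl)
open import Data.Fin.Subset using (Subset; ∣_∣; ⁅_⁆; _∪_; ⊥; inside; outside)
  renaming (_∈_ to _∈ₛ_; _∉_ to _∉ₛ_)
open import Data.Fin.Subset.Properties using (x∈p∪q⁺; x∈p∪q⁻; x∈⁅x⁆; x∈⁅y⁆⇒x≡y; ∉⊥; ∣⊥∣≡0; ∪-identityˡ)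
open import Data.Vec.Base using (_∷_; here; there)
open import Data.List using (List; []; _∷_; [_]; _++_; length; map; filter; foldr; take; concatMap;
  cartesianProduct; tabulate; allFin)
open import Data.List.Properties using (length-++; length-map; length-take; length-tabulate; take++drop≡id)
open import Data.List.Relation.Unary.Any using (here; there)
open import Data.List.Relation.Unary.All as All using (All; []; _∷_; all?)
import Data.List.Relation.Unary.All.Properties as All
open import Data.List.Relation.Unary.AllPairs as AllPairs using (AllPairs; []; _∷_)
import Data.List.Relation.Unary.AllPairs.Properties as AllPairs
open import Data.List.Relation.Unary.Unique.Propositional using (Unique)
import Data.List.Relation.Unary.Unique.Propositional.Properties as Unique
open import Data.List.Relation.Binary.Disjoint.Propositional using (Disjoint)
open import Data.List.Relation.Binary.Subset.Propositional using (_⊆_)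
open import Data.List.Relation.Binary.Permutation.Propositional.Properties using (shift; ↭-length)
open import Data.List.Membership.Propositional using (_∈_; _∉_; find)
open import Data.List.Membership.Propositional.Properties
  using (∈-∃++; ∈-++⁻; ∈-++⁺ˡ; ∈-++⁺ʳ; ∈-map⁺; ∈-map⁻; ∈-filter⁺; ∈-allFin; ∈-cartesianProduct⁺)
import Data.List.Membership.DecPropositional as DecMembership
open import Data.Product using (Σ; ∃; ∃₂; _×_; _,_; proj₁; proj₂)
open import Data.Product.Properties using (≡-dec)
open import Data.Sum using (_⊎_; inj₁; inj₂)
open import Data.Empty using (⊥-elim)
open import Function using (_∘_)
open import Level using (0ℓ)
open import Relation.Nullary using (¬_; yes; no; contradiction)
open import Relation.Nullary.Decidable using (_⊎-dec_)
open import Relation.Unary using (Pred; Decidable)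
open import Relation.Binary using (Rel; Symmetric; DecidableEquality)
open import Relation.Binary.PropositionalEquality using (_≡_; _≢_; refl; sym; trans; cong; cong₂; subst; module ≡-Reasoning)
open import Relation.Binary.Construct.Closure.ReflexiveTransitive using (Star; ε; _◅_)

module _ {A : Set} where

  length-≤-⊆ : {xs ys : List A} → Unique xs → xs ⊆ ys → length xs ≤ length ys
  length-≤-⊆ {[]} _ _ = z≤n
  length-≤-⊆ {x ∷ xs} (x∉xs ∷ xs-unique) xs⊆ys
    with ys₁ , ys₂ , refl ← ∈-∃++ (xs⊆ys (here refl)) = begin
      suc (length xs)              ≤⟨ s≤s (length-≤-⊆ xs-unique xs⊆ys₁++ys₂) ⟩
      suc (length (ys₁ ++ ys₂))    ≡⟨ ↭-length (shift x ys₁ ys₂) ⟨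
      length (ys₁ ++ [ x ] ++ ys₂) ∎
    where
      open ≤-Reasoning
      xs⊆ys₁++ys₂ : xs ⊆ ys₁ ++ ys₂
      xs⊆ys₁++ys₂ z∈xs with ∈-++⁻ ys₁ (xs⊆ys (there z∈xs))
      ... | inj₁ z∈ys₁         = ∈-++⁺ˡ z∈ys₁
      ... | inj₂ (here z≡x)    = contradiction (sym z≡x) (All.lookup x∉xs z∈xs)
      ... | inj₂ (there z∈ys₂) = ∈-++⁺ʳ ys₁ z∈ys₂

  module _ (_≟_ : DecidableEquality A) where

    open DecMembership _≟_ using (_∈?_)

    ∃-∉ : {xs ys : List A} → Unique xs → length ys < length xs → ∃ λ x → x ∈ xs × x ∉ ys
    ∃-∉ {xs} {ys} xs-unique ys<xs with all? (_∈? ys) xs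
    ... | yes xs⊆ys = contradiction (length-≤-⊆ xs-unique (All.lookup xs⊆ys)) (<⇒≱ ys<xs)
    ... | no xs⊈ys  = find (All.¬All⇒Any¬ (_∈? ys) xs xs⊈ys)

  map-injectiveOn⁺ : {B : Set} {f : A → B} {xs : List A} →
    (∀ {x y} → x ∈ xs → y ∈ xs → f x ≡ f y → x ≡ y) → Unique xs → Unique (map f xs)
  map-injectiveOn⁺ {xs = []} _ [] = []
  map-injectiveOn⁺ {xs = x ∷ xs} f-inj (x∉xs ∷ xs-unique) =
    All.map⁺ (All.tabulate λ y∈xs fx≡fy → All.lookup x∉xs y∈xs (f-inj (here refl) (there y∈xs) fx≡fy))
    ∷ map-injectiveOn⁺ (λ x∈ y∈ → f-inj (there x∈) (there y∈)) xs-unique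

  2≤length-filter : {P : Pred A 0ℓ} (P? : Decidable P) {xs : List A} {x y : A} →
    x ∈ xs → y ∈ xs → x ≢ y → P x → P y → 2 ≤ length (filter P? xs)
  2≤length-filter P? x∈xs y∈xs x≢y Px Py = length-≤-⊆ ((x≢y ∷ []) ∷ [] ∷ []) λ
    { (here refl)         → ∈-filter⁺ P? x∈xs Px
    ; (there (here refl)) → ∈-filter⁺ P? y∈xs Py }

  take-⊆ : ∀ k {xs : List A} → take k xs ⊆ xs
  take-⊆ k {xs} x∈ = subst (_ ∈_) (take++drop≡id k xs) (∈-++⁺ˡ x∈)

module _ {a} {A : Set a} {B : Set} where

  concatMap-unique : (f : A → List B) {xs : List A} → (∀ x → Unique (f x)) →
    AllPairs (λ x y → Disjoint (f x) (f y)) xs → Unique (concatMap f xs)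
  concatMap-unique f {xs} f-unique f-disjoint =
    Unique.concat⁺ (All.map⁺ (All.universal f-unique xs)) (AllPairs.map⁺ f-disjoint)

  concatMap-all : {P : Pred B 0ℓ} (f : A → List B) (xs : List A) →
    (∀ x → All P (f x)) → All P (concatMap f xs)
  concatMap-all f xs f-all = All.concat⁺ (All.map⁺ (All.universal f-all xs))

length-cartesianProduct : {A B : Set} (xs : List A) (ys : List B) →
  length (cartesianProduct xs ys) ≡ length xs * length ys
length-cartesianProduct [] ys = refl
length-cartesianProduct (x ∷ xs) ys = begin
  length (map (x ,_) ys ++ cartesianProduct xs ys)        ≡⟨ length-++ (map (x ,_) ys) ⟩
  length (map (x ,_) ys) + length (cartesianProduct xs ys) ≡⟨ cong₂ _+_ (length-map _ ys) (length-cartesianProduct xs ys) ⟩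
  length ys + length xs * length ys                        ∎
  where
    open ≡-Reasoning

≤-foldr-⊔ : {x : ℕ} {xs : List ℕ} → x ∈ xs → x ≤ foldr _⊔_ 0 xs
≤-foldr-⊔ {xs = y ∷ ys} (here refl)  = m≤m⊔n y _
≤-foldr-⊔ {xs = y ∷ ys} (there x∈ys) = ≤-trans (≤-foldr-⊔ x∈ys) (m≤n⊔m y _)

even⇒half+half : ∀ k → k % 2 ≡ 0 → k ≡ k / 2 + k / 2
even⇒half+half k k-even = begin
  k                 ≡⟨ m≡m%n+[m/n]*n k 2 ⟩
  k % 2 + k / 2 * 2 ≡⟨ cong (_+ k / 2 * 2) k-even ⟩
  k / 2 * 2         ≡⟨ double (k / 2) ⟩
  k / 2 + k / 2     ∎
  where
    open ≡-Reasoning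
    double : ∀ h → h * 2 ≡ h + h
    double = solve-∀

fromList : ∀ {n} → List (Fin n) → Subset n
fromList []       = ⊥
fromList (v ∷ vs) = ⁅ v ⁆ ∪ fromList vs

module _ {n : ℕ} where

  ∈-fromList⁺ : {u : Fin n} {vs : List (Fin n)} → u ∈ vs → u ∈ₛ fromList vs
  ∈-fromList⁺ {vs = v ∷ _} (here refl)  = x∈p∪q⁺ (inj₁ (x∈⁅x⁆ v))
  ∈-fromList⁺ {vs = _ ∷ _} (there u∈vs) = x∈p∪q⁺ (inj₂ (∈-fromList⁺ u∈vs))

  ∈-fromList⁻ : {u : Fin n} (vs : List (Fin n)) → u ∈ₛ fromList vs → u ∈ vs
  ∈-fromList⁻ []       u∈⊥ = ⊥-elim (∉⊥ u∈⊥)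
  ∈-fromList⁻ (v ∷ vs) u∈  with x∈p∪q⁻ ⁅ v ⁆ (fromList vs) u∈
  ... | inj₁ u∈⁅v⁆ = here (x∈⁅y⁆⇒x≡y v u∈⁅v⁆)
  ... | inj₂ u∈vs  = there (∈-fromList⁻ vs u∈vs)

∣⁅x⁆∪p∣ : ∀ {n} (x : Fin n) (p : Subset n) → x ∉ₛ p → ∣ ⁅ x ⁆ ∪ p ∣ ≡ suc ∣ p ∣
∣⁅x⁆∪p∣ fzero    (inside  ∷ p) x∉p = ⊥-elim (x∉p here)
∣⁅x⁆∪p∣ fzero    (outside ∷ p) _   = cong (suc ∘ ∣_∣) (∪-identityˡ p)
∣⁅x⁆∪p∣ (fsuc x) (inside  ∷ p) x∉p = cong suc (∣⁅x⁆∪p∣ x p (x∉p ∘ there))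
∣⁅x⁆∪p∣ (fsuc x) (outside ∷ p) x∉p = ∣⁅x⁆∪p∣ x p (x∉p ∘ there)

∣fromList∣ : ∀ {n} {vs : List (Fin n)} → Unique vs → ∣ fromList vs ∣ ≡ length vs
∣fromList∣ {n} {[]}     []                  = ∣⊥∣≡0 n
∣fromList∣ {vs = v ∷ vs} (v∉vs ∷ vs-unique) =
  trans (∣⁅x⁆∪p∣ v (fromList vs) (All.All¬⇒¬Any v∉vs ∘ ∈-fromList⁻ vs)) (cong suc (∣fromList∣ vs-unique))

module _ {A : Set} {R : Rel A 0ℓ} {X U : Pred A 0ℓ} (X? : Decidable X) (U? : Decidable U) where

  Star-crossing : ∀ {a b} → Star R a b → X a → U a → ¬ U b →
    (∃ λ y → ¬ X y × ∃ λ x → R x y) ⊎ (∃₂ λ x y → R x y × X x × U x × X y × ¬ U y)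
  Star-crossing ε                  _  Ua ¬Ub = contradiction Ua ¬Ub
  Star-crossing (_◅_ {j = y} x~y w) Xx Ux ¬Ub with X? y | U? y
  ... | no ¬Xy | _      = inj₁ (y , ¬Xy , _ , x~y)
  ... | yes Xy | no ¬Uy = inj₂ (_ , y , x~y , Xx , Ux , Xy , ¬Uy)
  ... | yes Xy | yes Uy = Star-crossing w Xy Uy ¬Ub

ArcIn : {A : Set} → Rel A 0ℓ → List A → A × A → Set
ArcIn R X (a , b) = R a b × a ∈ X × b ∈ X

module Spanning {A : Set} (_≟_ : DecidableEquality A) {R : Rel A 0ℓ} (R-sym : Symmetric R)
  (S : List A) (S-unique : Unique S) {s₀ : A} (s₀∈S : s₀ ∈ S)
  (reach : ∀ {u} → u ∈ S → Star R s₀ u) where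

  open DecMembership _≟_ using (_∈?_)

  Exit : Set
  Exit = ∃ λ y → y ∉ S × ∃ λ x → R x y

  record Explored (r : ℕ) : Set where
    field
      visited        : List A
      arcs           : List (A × A)
      visited-unique : Unique visited
      visited⊆S      : visited ⊆ S
      s₀-visited     : s₀ ∈ visited
      visited-length : length visited ≡ suc r
      arcs-unique    : Unique arcs
      arcs-visited   : All (ArcIn R visited) arcs
      arcs-length    : length arcs ≡ r + r

  open Explored

  start : Explored 0
  start = record
    { visited = [ s₀ ] ; arcs = []
    ; visited-unique = [] ∷ [] ; visited⊆S = λ { (here refl) → s₀∈S } ; s₀-visited = here refl
    ; visited-length = refl ; arcs-unique = [] ; arcs-visited = [] ; arcs-length = refl }

  extend : ∀ {r} (ex : Explored r) {x y} → R x y → x ∈ visited ex → y ∈ S → y ∉ visited ex →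
           Explored (suc r)
  extend {r} ex {x} {y} x~y x∈vis y∈S y∉vis = record
    { visited        = y ∷ visited ex
    ; arcs           = (x , y) ∷ (y , x) ∷ arcs ex
    ; visited-unique = All.¬Any⇒All¬ _ y∉vis ∷ visited-unique ex
    ; visited⊆S      = λ { (here refl) → y∈S ; (there z∈) → visited⊆S ex z∈ }
    ; s₀-visited     = there (s₀-visited ex)
    ; visited-length = cong suc (visited-length ex)
    ; arcs-unique    = (xy≢yx ∷ All.¬Any⇒All¬ _ (λ xy∈ → proj₂ (avoids-y xy∈) refl))
                     ∷ All.¬Any⇒All¬ _ (λ yx∈ → proj₁ (avoids-y yx∈) refl)
                     ∷ arcs-unique ex
    ; arcs-visited   = (x~y , there x∈vis , here refl) ∷ (R-sym x~y , here refl , there x∈vis)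
                     ∷ All.map (λ (a~b , a∈ , b∈) → a~b , there a∈ , there b∈) (arcs-visited ex)
    ; arcs-length    = cong suc (trans (cong suc (arcs-length ex)) (sym (+-suc r r)))
    }
    where
      avoids-y : ∀ {a b} → (a , b) ∈ arcs ex → a ≢ y × b ≢ y
      avoids-y ab∈ with _ , a∈ , b∈ ← All.lookup (arcs-visited ex) ab∈ =
        (λ { refl → y∉vis a∈ }) , (λ { refl → y∉vis b∈ })
      xy≢yx : (x , y) ≢ (y , x)
      xy≢yx refl = y∉vis x∈vis

  explore : ∀ r → r < length S → Exit ⊎ Explored r
  explore zero    _     = inj₂ start
  explore (suc r) r<|S| with explore r (≤-trans (n≤1+n (suc r)) r<|S|)
  ... | inj₁ exit = inj₁ exit
  ... | inj₂ ex
    with u , u∈S , u∉vis ← ∃-∉ _≟_ S-unique (subst (_< length S) (sym (visited-length ex)) r<|S|)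
    with Star-crossing (_∈? S) (_∈? visited ex) (reach u∈S) s₀∈S (s₀-visited ex) u∉vis
  ... | inj₁ exit = inj₁ exit
  ... | inj₂ (_ , _ , x~y , _ , x∈vis , y∈S , y∉vis) = inj₂ (extend ex x~y x∈vis y∈S y∉vis)

  spanning : ∀ c → length S ≡ suc c → Exit ⊎ ∃ λ L → Unique L × All (ArcIn R S) L × length L ≡ c + c
  spanning c |S| with explore c (≤-reflexive (sym |S|))
  ... | inj₁ exit = inj₁ exit
  ... | inj₂ ex   = inj₂ (arcs ex , arcs-unique ex ,
          All.map (λ (a~b , a∈ , b∈) → a~b , visited⊆S ex a∈ , visited⊆S ex b∈) (arcs-visited ex) ,
          arcs-length ex)

Touches : {A : Set} → A → A × A → Set
Touches v (a , b) = v ≡ a ⊎ v ≡ b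

IsMatching : {A : Set} → List (A × A) → Set
IsMatching es = ∀ {e e' v} → e ∈ es → e' ∈ es → Touches v e → Touches v e' → e ≡ e'

module _ {A : Set} {es : List (A × A)} (es-matching : IsMatching es) where

  heads-unique : Unique es → Unique (map proj₁ es)
  heads-unique = map-injectiveOn⁺ λ e∈ e'∈ eq → es-matching e∈ e'∈ (inj₁ refl) (inj₁ eq)

  tails-unique : Unique es → Unique (map proj₂ es)
  tails-unique = map-injectiveOn⁺ λ e∈ e'∈ eq → es-matching e∈ e'∈ (inj₂ refl) (inj₂ eq)

  heads-tails-disjoint : All (λ e → proj₁ e ≢ proj₂ e) es → Disjoint (map proj₁ es) (map proj₂ es)
  heads-tails-disjoint loopless (v∈heads , v∈tails)
    with e , e∈ , refl ← ∈-map⁻ proj₁ v∈heads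
    with e' , e'∈ , eq ← ∈-map⁻ proj₂ v∈tails
    with refl ← es-matching e∈ e'∈ (inj₁ refl) (inj₂ eq) = All.lookup loopless e∈ eq

maxDeg≡1⇒IsMatching : ∀ {n} (M : EdgeList n) → maxDeg M ≡ 1 → IsMatching M
maxDeg≡1⇒IsMatching M Δ≡1 {e} {e'} {v} e∈M e'∈M v~e v~e' with ≡-dec _≟F_ _≟F_ e e'
... | yes e≡e' = e≡e'
... | no  e≢e' = contradiction (≤-trans 2≤deg (≤-trans deg≤Δ (≤-reflexive Δ≡1))) 1+n≰n
  where
    2≤deg : 2 ≤ degM M v
    2≤deg = 2≤length-filter (λ e → (v ≟F proj₁ e) ⊎-dec (v ≟F proj₂ e)) e∈M e'∈M e≢e' v~e v~e'
    deg≤Δ : degM M v ≤ maxDeg M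
    deg≤Δ = ≤-foldr-⊔ (∈-map⁺ (degM M) (∈-allFin v))

-- With k = 3 + d = |S|, the weights 2(k − 1), 1 and 2(k − 2).
weight : ℕ → ℕ → ℕ → ℕ → ℕ
weight d outsiders arcs partners = 2 * (2 + d) * outsiders + arcs + 2 * (1 + d) * partners

outsider-weight : ∀ d → 2 * (2 + d) ≡ 2 * (2 + d) * 1 + 0 + 2 * (1 + d) * 0
outsider-weight = solve-∀

spanned-weight : ∀ d → 2 * (2 + d) ≡ 2 * (2 + d) * 0 + ((2 + d) + (2 + d)) + 2 * (1 + d) * 0
spanned-weight = solve-∀

partner-via-S-weight : ∀ d → 2 * (2 + d) ≡ 2 * (2 + d) * 0 + 2 + 2 * (1 + d) * 1
partner-via-S-weight = solve-∀

partner-via-P-weight : ∀ d → 2 * (2 + d) + 2 * d ≡ 2 * (2 + d) * 0 + 0 + 2 * (1 + d) * 2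
partner-via-P-weight = solve-∀

weight-+ : ∀ d o a p o' a' p' →
  (2 * (2 + d) * o + a + 2 * (1 + d) * p) + (2 * (2 + d) * o' + a' + 2 * (1 + d) * p')
    ≡ 2 * (2 + d) * (o + o') + (a + a') + 2 * (1 + d) * (p + p')
weight-+ = solve-∀

weighted-count-bound : ∀ {n m d h O A Q} → 3 + d ≡ h + h →
  m * (2 * (2 + d)) ≤ weight d O A Q →
  O + ((3 + d) + (3 + d)) ≤ n → Q ≤ 3 + d → A + (3 + d) ≤ (3 + d) * (3 + d) →
  m < n ∸ h ∸ 1
weighted-count-bound {n} {m} {d} {h} {O} {A} {Q} h+h m-weight O-bound Q-bound A-bound =
  m+n≤o⇒m≤o∸n (suc m) (m+n≤o⇒m≤o∸n (suc m + 1) (begin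
    suc m + 1 + h           ≤⟨ +-monoˡ-≤ h m+1<O+3h ⟩
    O + (h + h + h) + h     ≡⟨ regroup O h ⟩
    O + ((h + h) + (h + h)) ≡⟨ cong (λ k → O + (k + k)) h+h ⟨
    O + ((3 + d) + (3 + d)) ≤⟨ O-bound ⟩
    n                       ∎))
  where
    open ≤-Reasoning
    W = 2 * (2 + d)
    k = 3 + d
    regroup : ∀ O h → O + (h + h + h) + h ≡ O + ((h + h) + (h + h))
    regroup = solve-∀
    spread : ∀ m d → suc ((m + 1) * (2 * (2 + d))) + 1 + (3 + d) ≡ m * (2 * (2 + d)) + (2 * (2 + d) + 2 + (3 + d))
    spread = solve-∀
    gather : ∀ d O A Q → 2 * (2 + d) * O + A + 2 * (1 + d) * Q + (2 * (2 + d) + 2 + (3 + d))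
                       ≡ 2 * (2 + d) * O + (A + (3 + d)) + 2 * (1 + d) * Q + (2 * (2 + d) + 2)
    gather = solve-∀
    budget : ∀ d O → 2 * (2 + d) * O + (3 + d) * (3 + d) + 2 * (1 + d) * (3 + d) + (2 * (2 + d) + 2)
                   ≡ O * (2 * (2 + d)) + (3 + d) * (3 * (2 + d)) + (3 + d)
    budget = solve-∀
    thirds : ∀ O h d → O * (2 * (2 + d)) + (h + h) * (3 * (2 + d)) + (3 + d) ≡ (O + (h + h + h)) * (2 * (2 + d)) + (3 + d)
    thirds = solve-∀
    -- The budget exceeds the weight by 2, which is what makes the inequality strict.
    m+1<O+3h : m + 1 < O + (h + h + h)
    m+1<O+3h = *-cancelʳ-< W (m + 1) (O + (h + h + h)) (≤-trans (m≤m+n _ 1) (+-cancelʳ-≤ k _ _ (begin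
      suc ((m + 1) * W) + 1 + k                  ≡⟨ spread m d ⟩
      m * W + (W + 2 + k)                        ≤⟨ +-monoˡ-≤ _ m-weight ⟩
      weight d O A Q + (W + 2 + k)               ≡⟨ gather d O A Q ⟩
      W * O + (A + k) + 2 * (1 + d) * Q + (W + 2)
        ≤⟨ +-monoˡ-≤ (W + 2) (+-mono-≤ (+-monoʳ-≤ (W * O) A-bound) (*-monoʳ-≤ (2 * (1 + d)) Q-bound)) ⟩
      W * O + k * k + 2 * (1 + d) * k + (W + 2)   ≡⟨ budget d O ⟩
      O * W + k * (3 * (2 + d)) + k              ≡⟨ cong (λ x → O * W + x * (3 * (2 + d)) + k) h+h ⟩
      O * W + (h + h) * (3 * (2 + d)) + k        ≡⟨ thirds O h d ⟩
      (O + (h + h + h)) * W + k                  ∎)))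

module Charging
  {n : ℕ} {Adj : Fin n → Fin n → Set} (Adj-irrefl : ∀ {u v} → Adj u v → u ≢ v)
  (d : ℕ) (S P : List (Fin n)) (|S| : length S ≡ 3 + d) (|P| : length P ≡ 3 + d)
  (S-unique : Unique S) (P-unique : Unique P) (S∩P≡∅ : Disjoint S P)
  (partner : ∀ {p} → p ∈ P → ∃ λ s → s ∈ S × ¬ Adj s p) where

  open DecMembership (_≟F_ {n}) using (_∈?_)

  S-Tree : Set₁
  S-Tree = STree Adj (fromList S)

  record Charge (T : S-Tree) : Set where
    field
      outsiders partners     : List (Fin n)
      arcs          : List (Fin n × Fin n)
      outsiders-unique   : Unique outsiders
      partners-unique   : Unique partners
      arcs-unique   : Unique arcs
      outsiders-avoid-S∪P  : All (λ v → V (tree T) v × v ∉ S × v ∉ P) outsiders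
      partners-in-P : All (λ v → V (tree T) v × v ∈ P) partners
      arcs-inside   : All (ArcIn (E (tree T)) S) arcs
      heavy         : 2 * (2 + d) ≤ weight d (length outsiders) (length arcs) (length partners)

  open Charge

  S-inhabited : ∃ (_∈ S)
  S-inhabited = inhabited S |S|
    where
      inhabited : ∀ xs → length xs ≡ 3 + d → ∃ (_∈ xs)
      inhabited (x ∷ _) _ = x , here refl

  module _ (T : S-Tree) where

    outsider : ∀ {o} → V (tree T) o → o ∉ S → o ∉ P → Charge T
    outsider {o} o∈T o∉S o∉P = record
      { outsiders = [ o ] ; partners = [] ; arcs = []
      ; outsiders-unique = [] ∷ [] ; partners-unique = [] ; arcs-unique = []
      ; outsiders-avoid-S∪P = (o∈T , o∉S , o∉P) ∷ [] ; partners-in-P = [] ; arcs-inside = []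
      ; heavy = ≤-reflexive (outsider-weight d) }

    spanned : ∀ {L} → Unique L → All (ArcIn (E (tree T)) S) L → length L ≡ (2 + d) + (2 + d) → Charge T
    spanned {L} L-unique L-inside |L| = record
      { outsiders = [] ; partners = [] ; arcs = L
      ; outsiders-unique = [] ; partners-unique = [] ; arcs-unique = L-unique
      ; outsiders-avoid-S∪P = [] ; partners-in-P = [] ; arcs-inside = L-inside
      ; heavy = ≤-reflexive (trans (spanned-weight d) (cong (λ a → weight d 0 a 0) (sym |L|))) }

    partner-via-S : ∀ {s y o} → E (tree T) s y → s ∈ S → y ∈ S → V (tree T) o → o ∈ P → Charge T
    partner-via-S {s} {y} {o} s~y s∈S y∈S o∈T o∈P = record
      { outsiders = [] ; partners = [ o ] ; arcs = (s , y) ∷ (y , s) ∷ []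
      ; outsiders-unique = [] ; partners-unique = [] ∷ []
      ; arcs-unique = ((λ sy≡ys → Adj-irrefl (E-adj (tree T) s~y) (cong proj₁ sy≡ys)) ∷ []) ∷ [] ∷ []
      ; outsiders-avoid-S∪P = [] ; partners-in-P = (o∈T , o∈P) ∷ []
      ; arcs-inside = (s~y , s∈S , y∈S) ∷ (E-sym (tree T) s~y , y∈S , s∈S) ∷ []
      ; heavy = ≤-reflexive (partner-via-S-weight d) }

    partner-via-P : ∀ {s y o} → E (tree T) s y → ¬ Adj s o → V (tree T) o → o ∈ P → y ∈ P → Charge T
    partner-via-P {s} {y} {o} s~y s≁o o∈T o∈P y∈P = record
      { outsiders = [] ; partners = o ∷ y ∷ [] ; arcs = []
      ; outsiders-unique = [] ; partners-unique = ((λ { refl → s≁o (E-adj (tree T) s~y) }) ∷ []) ∷ [] ∷ [] ; arcs-unique = []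
      ; outsiders-avoid-S∪P = [] ; partners-in-P = (o∈T , o∈P) ∷ (E-V (tree T) (E-sym (tree T) s~y) , y∈P) ∷ []
      ; arcs-inside = []
      ; heavy = ≤-trans (m≤m+n (2 * (2 + d)) (2 * d)) (≤-reflexive (partner-via-P-weight d)) }

    connected : ∀ {u v} → V (tree T) u → V (tree T) v → Star (E (tree T)) u v
    connected = proj₁ (isTree T) _ _

    inT : ∀ {s} → s ∈ S → V (tree T) s
    inT s∈S = contains T _ (∈-fromList⁺ s∈S)

    via-partner : ∀ {o} → V (tree T) o → o ∉ S → o ∈ P → Charge T
    via-partner {o} o∈T o∉S o∈P
      with s , s∈S , s≁o ← partner o∈P
      with connected (inT s∈S) o∈T
    ... | ε = contradiction s∈S o∉S
    ... | _◅_ {j = y} s~y _ with y ∈? S | y ∈? P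
    ...   | yes y∈S | _       = partner-via-S s~y s∈S y∈S o∈T o∈P
    ...   | no  y∉S | no  y∉P = outsider (E-V (tree T) (E-sym (tree T) s~y)) y∉S y∉P
    ...   | no  _   | yes y∈P = partner-via-P s~y s≁o o∈T o∈P y∈P

    charge : Charge T
    charge with s₀ , s₀∈S ← S-inhabited
      with Spanning.spanning _≟F_ (E-sym (tree T)) S S-unique s₀∈S (connected (inT s₀∈S) ∘ inT) (2 + d) |S|
    ... | inj₂ (L , L-unique , L-inside , |L|) = spanned L-unique L-inside |L|
    ... | inj₁ (o , o∉S , _ , x~o) with o ∈? P
    ...   | no  o∉P = outsider (E-V (tree T) (E-sym (tree T) x~o)) o∉S o∉P
    ...   | yes o∈P = via-partner (E-V (tree T) (E-sym (tree T) x~o)) o∉S o∈P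

  shared⇒∈S : ∀ {T T' : S-Tree} → InternallyDisjoint T T' → ∀ {v} → V (tree T) v → V (tree T') v → v ∈ S
  shared⇒∈S (_ , shared) v∈T v∈T' = ∈-fromList⁻ S (proj₁ (shared _) (v∈T , v∈T'))

  outsiders-disjoint : ∀ {T T' : S-Tree} → InternallyDisjoint T T' → Disjoint (outsiders (charge T)) (outsiders (charge T'))
  outsiders-disjoint {T} {T'} TT' (v∈ , v∈')
    with v∈T , v∉S , _ ← All.lookup (outsiders-avoid-S∪P (charge T)) v∈
    with v∈T' , _ ← All.lookup (outsiders-avoid-S∪P (charge T')) v∈' = v∉S (shared⇒∈S {T} {T'} TT' v∈T v∈T')

  partners-disjoint : ∀ {T T' : S-Tree} → InternallyDisjoint T T' → Disjoint (partners (charge T)) (partners (charge T'))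
  partners-disjoint {T} {T'} TT' (v∈ , v∈')
    with v∈T , v∈P ← All.lookup (partners-in-P (charge T)) v∈
    with v∈T' , _ ← All.lookup (partners-in-P (charge T')) v∈' = S∩P≡∅ (shared⇒∈S {T} {T'} TT' v∈T v∈T' , v∈P)

  arcs-disjoint : ∀ {T T' : S-Tree} → InternallyDisjoint T T' → Disjoint (arcs (charge T)) (arcs (charge T'))
  arcs-disjoint {T} {T'} (edge-disjoint , _) (e∈ , e∈')
    with a~b , _ ← All.lookup (arcs-inside (charge T)) e∈
    with a~'b , _ ← All.lookup (arcs-inside (charge T')) e∈' = edge-disjoint _ _ (a~b , a~'b)

  allOutsiders allPartners : List S-Tree → List (Fin n)
  allOutsiders = concatMap (outsiders ∘ charge)
  allPartners = concatMap (partners ∘ charge)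

  allArcs : List S-Tree → List (Fin n × Fin n)
  allArcs = concatMap (arcs ∘ charge)

  module _ {ts : List S-Tree} (ts-disjoint : AllPairs InternallyDisjoint ts) where

    allOutsiders-avoid-S∪P : All (λ v → v ∉ S × v ∉ P) (allOutsiders ts)
    allOutsiders-avoid-S∪P =
      concatMap-all (outsiders ∘ charge) ts (All.map proj₂ ∘ outsiders-avoid-S∪P ∘ charge)

    outsiders-bound : length (allOutsiders ts) + ((3 + d) + (3 + d)) ≤ n
    outsiders-bound = begin
      length (allOutsiders ts) + ((3 + d) + (3 + d))   ≡⟨ cong₂ (λ a b → length (allOutsiders ts) + (a + b)) |S| |P| ⟨
      length (allOutsiders ts) + (length S + length P) ≡⟨ cong (length (allOutsiders ts) +_) (length-++ S) ⟨
      length (allOutsiders ts) + length (S ++ P)       ≡⟨ length-++ (allOutsiders ts) ⟨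
      length (allOutsiders ts ++ S ++ P)               ≤⟨ length-≤-⊆ unique (λ _ → ∈-allFin _) ⟩
      length (allFin n)                                ≡⟨ length-tabulate _ ⟩
      n                                                ∎
      where
        open ≤-Reasoning
        avoids-S++P : Disjoint (allOutsiders ts) (S ++ P)
        avoids-S++P (v∈ , v∈S++P) with v∉S , v∉P ← All.lookup allOutsiders-avoid-S∪P v∈
          with ∈-++⁻ S v∈S++P
        ... | inj₁ v∈S = v∉S v∈S
        ... | inj₂ v∈P = v∉P v∈P
        unique : Unique (allOutsiders ts ++ S ++ P)
        unique = Unique.++⁺
          (concatMap-unique (outsiders ∘ charge) (outsiders-unique ∘ charge) (AllPairs.map outsiders-disjoint ts-disjoint))
          (Unique.++⁺ S-unique P-unique S∩P≡∅) avoids-S++P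

    partners-bound : length (allPartners ts) ≤ 3 + d
    partners-bound = ≤-trans (length-≤-⊆ unique (All.lookup allPartners-in-P)) (≤-reflexive |P|)
      where
        unique = concatMap-unique (partners ∘ charge) (partners-unique ∘ charge)
          (AllPairs.map partners-disjoint ts-disjoint)
        allPartners-in-P : All (_∈ P) (allPartners ts)
        allPartners-in-P = concatMap-all (partners ∘ charge) ts (All.map proj₂ ∘ partners-in-P ∘ charge)

    arcs-bound : length (allArcs ts) + (3 + d) ≤ (3 + d) * (3 + d)
    arcs-bound = begin
      length (allArcs ts) + (3 + d)         ≡⟨ cong (length (allArcs ts) +_) (trans (length-map _ S) |S|) ⟨
      length (allArcs ts) + length diagonal ≡⟨ length-++ (allArcs ts) ⟨
      length (allArcs ts ++ diagonal)       ≤⟨ length-≤-⊆ unique within ⟩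
      length (cartesianProduct S S)         ≡⟨ length-cartesianProduct S S ⟩
      length S * length S                   ≡⟨ cong₂ _*_ |S| |S| ⟩
      (3 + d) * (3 + d)                     ∎
      where
        open ≤-Reasoning
        diagonal = map (λ s → s , s) S
        allArcs-proper : All (ArcIn _≢_ S) (allArcs ts)
        allArcs-proper = concatMap-all (arcs ∘ charge) ts λ T →
          All.map (λ (a~b , a∈ , b∈) → Adj-irrefl (E-adj (tree T) a~b) , a∈ , b∈) (arcs-inside (charge T))
        off-diagonal : Disjoint (allArcs ts) diagonal
        off-diagonal (e∈ , e∈diag) with _ , _ , refl ← ∈-map⁻ _ e∈diag =
          proj₁ (All.lookup allArcs-proper e∈) refl
        unique : Unique (allArcs ts ++ diagonal)
        unique = Unique.++⁺
          (concatMap-unique (arcs ∘ charge) (arcs-unique ∘ charge) (AllPairs.map arcs-disjoint ts-disjoint))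
          (Unique.map⁺ (cong proj₁) S-unique) off-diagonal
        within : allArcs ts ++ diagonal ⊆ cartesianProduct S S
        within e∈ with ∈-++⁻ (allArcs ts) e∈
        ... | inj₁ e∈arcs with _ , a∈ , b∈ ← All.lookup allArcs-proper e∈arcs = ∈-cartesianProduct⁺ a∈ b∈
        ... | inj₂ e∈diag with _ , s∈ , refl ← ∈-map⁻ _ e∈diag = ∈-cartesianProduct⁺ s∈ s∈

  weight-total : (ts : List S-Tree) →
    length ts * (2 * (2 + d)) ≤ weight d (length (allOutsiders ts)) (length (allArcs ts)) (length (allPartners ts))
  weight-total []       = z≤n
  weight-total (T ∷ ts) = begin
    suc (length ts) * (2 * (2 + d))
      ≤⟨ +-mono-≤ (heavy (charge T)) (weight-total ts) ⟩
    weight d (length o) (length a) (length p) + weight d (length O) (length A) (length P')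
      ≡⟨ weight-+ d (length o) (length a) (length p) (length O) (length A) (length P') ⟩
    weight d (length o + length O) (length a + length A) (length p + length P')
      ≡⟨ cong₃ (weight d) (length-++ o) (length-++ a) (length-++ p) ⟨
    weight d (length (o ++ O)) (length (a ++ A)) (length (p ++ P')) ∎
    where
      open ≤-Reasoning
      o = outsiders (charge T) ; a = arcs (charge T) ; p = partners (charge T)
      O = allOutsiders ts ; A = allArcs ts ; P' = allPartners ts
      cong₃ : ∀ f {x x' y y' z z'} → x ≡ x' → y ≡ y' → z ≡ z' → f x y z ≡ f x' y' z'
      cong₃ f refl refl refl = refl

  few-trees : ∀ {h} → 3 + d ≡ h + h → KappaSLess Adj (fromList S) (n ∸ h ∸ 1)
  few-trees {h} h+h m T T-disjoint =
    weighted-count-bound {h = h} {O} {A} {Q} h+h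
      (subst (λ m → m * (2 * (2 + d)) ≤ weight d O A Q) (length-tabulate T) (weight-total ts))
      (outsiders-bound ts-disjoint) (partners-bound ts-disjoint) (arcs-bound ts-disjoint)
    where
      ts = tabulate T
      O = length (allOutsiders ts)
      A = length (allArcs ts)
      Q = length (allPartners ts)
      ts-disjoint : AllPairs InternallyDisjoint ts
      ts-disjoint = AllPairs.tabulate⁺ λ {i} {j} → T-disjoint i j

lemma8 : (n k : ℕ) → 4 ≤ k → k ≤ n → k % 2 ≡ 0 →
    (M : EdgeList n) → Unique M → All (λ e → proj₁ e <F proj₂ e) M →
    k ≤ length M → maxDeg M ≡ 1 →
    (¬ Connected (AdjKnM M)) ⊎
    Σ (Subset n) (λ S → (∣ S ∣ ≡ k) × KappaSLess (AdjKnM M) S (n ∸ k / 2 ∸ 1))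
lemma8 n k@(suc (suc (suc d))) (s≤s (s≤s (s≤s (s≤s _)))) _ k-even M M-unique M-sorted k≤|M| Δ≡1 =
  inj₂ (fromList S , trans (∣fromList∣ S-unique) |S| , few-trees {k / 2} (even⇒half+half k k-even))
  where
    es = take k M
    S = map proj₁ es
    P = map proj₂ es
    |es| : length es ≡ k
    |es| = trans (length-take k M) (m≤n⇒m⊓n≡m k≤|M|)
    |S| : length S ≡ k
    |S| = trans (length-map proj₁ es) |es|
    |P| : length P ≡ k
    |P| = trans (length-map proj₂ es) |es|
    es-unique : Unique es
    es-unique = Unique.take⁺ k M-unique
    es-matching : IsMatching es
    es-matching e∈ e'∈ = maxDeg≡1⇒IsMatching M Δ≡1 (take-⊆ k e∈) (take-⊆ k e'∈)
    S-unique = heads-unique es-matching es-unique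
    es-loopless : All (λ e → proj₁ e ≢ proj₂ e) es
    es-loopless = All.map (λ s<p s≡p → <F-irrefl s≡p s<p) (All.take⁺ k M-sorted)
    partner : ∀ {p} → p ∈ P → ∃ λ s → s ∈ S × ¬ AdjKnM M s p
    partner p∈P with e , e∈ , refl ← ∈-map⁻ proj₂ p∈P =
      proj₁ e , ∈-map⁺ proj₁ e∈ , λ (_ , ∉M) → ∉M (inj₁ (take-⊆ k e∈))
    open Charging proj₁ d S P |S| |P| S-unique (tails-unique es-matching es-unique)
      (heads-tails-disjoint es-matching es-loopless) partner
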